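{- If $r\ge 3$, then $\mathrm{gcover_e}(\mathrm{BN}(r))=\mathrm{gpart_e}(\mathrm{BN}(r))=2^{r+1}$.
   Context: For $r\ge 3$, the $r$-dimensional Benes network $\mathrm{BN}(r)$ has vertex set $\{[s,i]: s\in\{0,1\}^r,\ i\in\{0,1,\ldots,2r\}\}$ ($i$ is the level of $[s,i]$). All edges join consecutive levels. For $1\le i\le r$, the vertex $[s,i-1]$ is adjacent to $[s',i]$ iff $s'=s$ or $s'$ differs from $s$ exactly in the $i$-th bit. For $r+1\le i\le 2r$, the vertex $[s,i-1]$ is adjacent to $[s',i]$ iff $s'=s$ or $s'$ differs from $s$ exactly in the $(2r+1-i)$-th bit (the second half is the mirror image of the first, so $\mathrm{BN}(r)$ is two back-to-back butterflies sharing level $r$). A geodesic is a shortest path. $\mathrm{gcover_e}(G)$ is the minimum number of geodesics of $G$ such that every edge lies on at least one of them; $\mathrm{gpart_e}(G)$ is the minimum number of geodesics such that every edge lies on exactly one of them. -}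

module Defs where

open import Data.Nat using (ℕ; zero; suc; _+_; _*_; _∸_; _^_; _≤_; _<ᵇ_)
open import Data.Bool using (Bool; true; false; if_then_else_)
open import Data.Fin using (Fin; toℕ)
open import Data.Vec using (Vec; lookup)
open import Data.List using (List; []; _∷_; length)
open import Data.Product using (_×_; _,_; Σ; ∃; ∃-syntax)
open import Data.Sum using (_⊎_)
open import Data.Unit using (⊤)
open import Data.Empty using (⊥)
open import Relation.Binary.PropositionalEquality using (_≡_; _≢_)

-- Vertex [s,i]: s ∈ {0,1}^r (bit k, 1-based, is lookup s (k-1)),
-- level i ∈ {0,…,2r}.
Vertex : ℕ → Set
Vertex r = Vec Bool r × Fin (suc (2 * r))

-- For the edges between level i-1 and level i (1 ≤ i ≤ 2r) we write
-- t = i - 1 ∈ {0,…,2r-1}.  The relevant bit (0-based index) is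
--   i - 1 = t             if i ≤ r   (i.e. t < r),
--   (2r+1-i) - 1 = 2r-1-t if i ≥ r+1 (i.e. t ≥ r).
bitIndex : ℕ → ℕ → ℕ
bitIndex r t = if t <ᵇ r then t else (2 * r ∸ 1) ∸ t

DiffExactlyAt : {r : ℕ} → ℕ → Vec Bool r → Vec Bool r → Set
DiffExactlyAt {r} b s s' =
  (k : Fin r) → (toℕ k ≡ b → lookup s k ≢ lookup s' k)
              × (toℕ k ≢ b → lookup s k ≡ lookup s' k)

Up : (r : ℕ) → Vertex r → Vertex r → Set
Up r (s , i) (s' , j) =
  (toℕ j ≡ suc (toℕ i)) × (s' ≡ s ⊎ DiffExactlyAt (bitIndex r (toℕ i)) s s')

Adj : (r : ℕ) → Vertex r → Vertex r → Set
Adj r u v = Up r u v ⊎ Up r v u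

Chain : {r : ℕ} → List (Vertex r) → Set
Chain [] = ⊤
Chain (x ∷ []) = ⊤
Chain {r} (x ∷ y ∷ xs) = Adj r x y × Chain {r} (y ∷ xs)

lastOf : {A : Set} → A → List A → A
lastOf x [] = x
lastOf x (y ∷ ys) = lastOf y ys

record Geodesic (r : ℕ) : Set where
  field
    start    : Vertex r
    rest     : List (Vertex r)
    chain    : Chain {r} (start ∷ rest)
    shortest : (rest' : List (Vertex r)) → Chain {r} (start ∷ rest') →
               lastOf start rest' ≡ lastOf start rest →
               length rest ≤ length rest'

open Geodesic public

EdgeOnList : {A : Set} → A → A → List A → Set
EdgeOnList u v [] = ⊥
EdgeOnList u v (x ∷ []) = ⊥
EdgeOnList u v (x ∷ y ∷ xs) =
  ((x ≡ u × y ≡ v) ⊎ (x ≡ v × y ≡ u)) ⊎ EdgeOnList u v (y ∷ xs)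

EdgeOn : {r : ℕ} → Vertex r → Vertex r → Geodesic r → Set
EdgeOn u v g = EdgeOnList u v (start g ∷ rest g)

IsEdgeGeodesicCover : (r k : ℕ) → (Fin k → Geodesic r) → Set
IsEdgeGeodesicCover r k f =
  (u v : Vertex r) → Adj r u v → ∃[ i ] EdgeOn u v (f i)

IsEdgeGeodesicPartition : (r k : ℕ) → (Fin k → Geodesic r) → Set
IsEdgeGeodesicPartition r k f =
  (u v : Vertex r) → Adj r u v →
    ∃[ i ] (EdgeOn u v (f i) × ((j : Fin k) → EdgeOn u v (f j) → j ≡ i))

GcoverE≡ : ℕ → ℕ → Set
GcoverE≡ r n =
  (Σ (Fin n → Geodesic r) (IsEdgeGeodesicCover r n))
  × ((k : ℕ) (f : Fin k → Geodesic r) → IsEdgeGeodesicCover r k f → n ≤ k)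

GpartE≡ : ℕ → ℕ → Set
GpartE≡ r n =
  (Σ (Fin n → Geodesic r) (IsEdgeGeodesicPartition r n))
  × ((k : ℕ) (f : Fin k → Geodesic r) → IsEdgeGeodesicPartition r k f → n ≤ k)

-- BN(r) has 2r levels of edges with 2^(r+1) edges each.  Its diameter is 2r: from [s,i] to [s',j]
-- (i ≤ j) walk straight down to level 0 and cross the lower butterfly, which joins any two bit
-- vectors in r steps, if i + j ≤ 2r, and cross the upper butterfly otherwise.  So a geodesic has
-- at most 2r edges and a geodesic cover has at least 2^(r+1) members.  Conversely, for c ∈ {0,1}
-- and s ∈ {0,1}^r let P(c,s) start at [s,0] and climb to level 2r always along straight edges
-- (c = 0) or always along cross edges (c = 1).  P(c,s) climbs one level per step, so it is a
-- geodesic, and an edge lies on P(c,s) exactly when c records whether it is a cross edge and s is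
-- what remains of the edge's lower endpoint after undoing the flips below it.  These 2^(r+1)
-- geodesics therefore partition the edges.

module Submission where

open import Data.Bool using (Bool; true; false; not)
open import Data.Bool.Properties using (not-involutive; not-¬; ¬-not)
open import Data.Empty using (⊥-elim)
open import Data.Fin using (Fin; zero; suc; toℕ; fromℕ<)
open import Data.Fin.Properties using (2↔Bool; *↔×; injective⇒≤; toℕ<n; toℕ-injective; toℕ-fromℕ<)
open import Data.List using (List; []; _∷_; length; applyUpTo; _++_)
open import Data.List.Properties using (length-++; length-applyUpTo)
open import Data.Nat using (ℕ; zero; suc; _+_; _*_; _∸_; _^_; _<_; _≤_; _<ᵇ_; _≤?_; _<?_; ∣_-_∣; s≤s; z≤n; z<s; s≤s⁻¹; >-nonZero)
open import Data.Nat.Properties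
open import Algebra.Properties.CommutativeSemigroup +-commutativeSemigroup using (x∙yz≈y∙xz)
open import Data.Nat.Tactic.RingSolver using (solve-∀)
open import Data.Product using (_×_; _,_; proj₁; proj₂; ∃-syntax)
open import Data.Product.Function.NonDependent.Propositional using (_×-↔_)
open import Data.Sum using (_⊎_; inj₁; inj₂; swap)
open import Data.Unit using (tt)
open import Data.Vec using (Vec; []; _∷_; head; tail; uncons)
open import Data.Vec.Relation.Binary.Pointwise.Extensional using (ext; Pointwise-≡⇒≡)
open import Function using (_∘_)
open import Function.Bundles using (_↔_; _↣_; Inverse; Injection; mk↔ₛ′; mk↣)
open import Function.Properties.Injection using (↣-trans)
open import Function.Properties.Inverse using (↔-refl; ↔-sym; ↔-trans; ↔⇒↣)
open import Relation.Binary.PropositionalEquality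
open import Relation.Nullary using (yes; no)
open import Relation.Nullary.Reflects using (ofʸ; ofⁿ)

open import Defs

flip : ∀ {n} → ℕ → Vec Bool n → Vec Bool n
flip _       []       = []
flip zero    (x ∷ xs) = not x ∷ xs
flip (suc b) (x ∷ xs) = x ∷ flip b xs

flipIf : ∀ {n} → Bool → ℕ → Vec Bool n → Vec Bool n
flipIf false _ xs = xs
flipIf true  b xs = flip b xs

flip-involutive : ∀ {n} b (xs : Vec Bool n) → flip b (flip b xs) ≡ xs
flip-involutive _       []       = refl
flip-involutive zero    (x ∷ xs) = cong (_∷ xs) (not-involutive x)
flip-involutive (suc b) (x ∷ xs) = cong (x ∷_) (flip-involutive b xs)

flipIf-involutive : ∀ {n} c b (xs : Vec Bool n) → flipIf c b (flipIf c b xs) ≡ xs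
flipIf-involutive false b xs = refl
flipIf-involutive true  b xs = flip-involutive b xs

flip-≢ : ∀ {n b} (xs : Vec Bool n) → b < n → flip b xs ≢ xs
flip-≢ {b = zero}  (x ∷ xs) _         eq = not-¬ refl (sym (cong head eq))
flip-≢ {b = suc b} (x ∷ xs) (s≤s b<n) eq = flip-≢ xs b<n (cong tail eq)

flipIf-injective : ∀ {n b c c′} (xs : Vec Bool n) → b < n → flipIf c b xs ≡ flipIf c′ b xs → c ≡ c′
flipIf-injective {c = false} {false} xs b<n eq = refl
flipIf-injective {c = false} {true}  xs b<n eq = ⊥-elim (flip-≢ xs b<n (sym eq))
flipIf-injective {c = true}  {false} xs b<n eq = ⊥-elim (flip-≢ xs b<n eq)
flipIf-injective {c = true}  {true}  xs b<n eq = refl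

flip-diffExactlyAt : ∀ {n} b (xs : Vec Bool n) → DiffExactlyAt b xs (flip b xs)
flip-diffExactlyAt zero    (x ∷ xs) zero    = (λ _ → not-¬ refl) , (λ 0≢0 → ⊥-elim (0≢0 refl))
flip-diffExactlyAt zero    (x ∷ xs) (suc k) = (λ ()) , (λ _ → refl)
flip-diffExactlyAt (suc b) (x ∷ xs) zero    = (λ ()) , (λ _ → refl)
flip-diffExactlyAt (suc b) (x ∷ xs) (suc k) =
  let at , off = flip-diffExactlyAt b xs k in at ∘ suc-injective , λ k≢b → off (k≢b ∘ cong suc)

diffExactlyAt⇒≡flip : ∀ {n} b {xs ys : Vec Bool n} → DiffExactlyAt b xs ys → ys ≡ flip b xs
diffExactlyAt⇒≡flip b       {[]}     {[]}     d = refl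
diffExactlyAt⇒≡flip zero    {x ∷ xs} {y ∷ ys} d =
  cong₂ _∷_ (¬-not (≢-sym (proj₁ (d zero) refl)))
            (Pointwise-≡⇒≡ (ext λ k → sym (proj₂ (d (suc k)) λ ())))
diffExactlyAt⇒≡flip (suc b) {x ∷ xs} {y ∷ ys} d =
  cong₂ _∷_ (sym (proj₂ (d zero) λ ()))
            (diffExactlyAt⇒≡flip b λ k → proj₁ (d (suc k)) ∘ cong suc , λ k≢b → proj₂ (d (suc k)) (k≢b ∘ suc-injective))

flipIf-sameOrDiffExactlyAt : ∀ {n} c b (xs : Vec Bool n) → flipIf c b xs ≡ xs ⊎ DiffExactlyAt b xs (flipIf c b xs)
flipIf-sameOrDiffExactlyAt false b xs = inj₁ refl
flipIf-sameOrDiffExactlyAt true  b xs = inj₂ (flip-diffExactlyAt b xs)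

sameOrDiffExactlyAt⇒flipIf : ∀ {n} b {xs ys : Vec Bool n} → ys ≡ xs ⊎ DiffExactlyAt b xs ys → ∃[ c ] ys ≡ flipIf c b xs
sameOrDiffExactlyAt⇒flipIf b (inj₁ eq) = false , eq
sameOrDiffExactlyAt⇒flipIf b (inj₂ d)  = true , diffExactlyAt⇒≡flip b d

splice : ∀ {n} → ℕ → Vec Bool n → Vec Bool n → Vec Bool n
splice zero    xs       ys       = ys
splice (suc m) []       []       = []
splice (suc m) (x ∷ xs) (y ∷ ys) = x ∷ splice m xs ys

flipIf-∷ : ∀ {n} c b x (xs : Vec Bool n) → flipIf c (suc b) (x ∷ xs) ≡ x ∷ flipIf c b xs
flipIf-∷ false b x xs = refl
flipIf-∷ true  b x xs = refl

splice-suc : ∀ {n} m (xs ys : Vec Bool n) → ∃[ c ] splice (suc m) xs ys ≡ flipIf c m (splice m xs ys)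
splice-suc zero    []           []           = false , refl
splice-suc (suc m) []           []           = false , refl
splice-suc zero    (false ∷ xs) (false ∷ ys) = false , refl
splice-suc zero    (false ∷ xs) (true  ∷ ys) = true , refl
splice-suc zero    (true  ∷ xs) (false ∷ ys) = true , refl
splice-suc zero    (true  ∷ xs) (true  ∷ ys) = false , refl
splice-suc (suc m) (x ∷ xs)     (y ∷ ys)     =
  let c , eq = splice-suc m xs ys in c , trans (cong (x ∷_) eq) (sym (flipIf-∷ c m x _))

splice-full : ∀ {n} (xs ys : Vec Bool n) → splice n xs ys ≡ xs
splice-full []       []       = refl
splice-full (x ∷ xs) (y ∷ ys) = cong (x ∷_) (splice-full xs ys)

Vec↔× : ∀ {a} {A : Set a} {n} → Vec A (suc n) ↔ (A × Vec A n)
Vec↔× = mk↔ₛ′ uncons (λ (x , xs) → x ∷ xs) (λ _ → refl) (λ { (x ∷ xs) → refl })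

Bits↔Fin : ∀ n → Vec Bool n ↔ Fin (2 ^ n)
Bits↔Fin zero    = mk↔ₛ′ (λ _ → zero) (λ _ → []) (λ { zero → refl }) (λ { [] → refl })
Bits↔Fin (suc n) = ↔-trans Vec↔× (↔-trans (↔-sym 2↔Bool ×-↔ Bits↔Fin n) (↔-sym *↔×))

↣⇒≤ : ∀ {a b} {A : Set a} {B : Set b} {m n} → A ↔ Fin m → B ↔ Fin n → A ↣ B → m ≤ n
↣⇒≤ A↔m B↔n A↣B =
  injective⇒≤ (Injection.injective (↣-trans (↔⇒↣ (↔-sym A↔m)) (↣-trans A↣B (↔⇒↣ B↔n))))

Joins : ∀ {a} {A : Set a} → A → A → A → A → Set a
Joins u v x y = (x ≡ u × y ≡ v) ⊎ (x ≡ v × y ≡ u)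

Joins-sym : ∀ {a} {A : Set a} {u v x y : A} → Joins u v x y → Joins v u x y
Joins-sym (inj₁ p) = inj₂ p
Joins-sym (inj₂ p) = inj₁ p

Joins-trans : ∀ {a} {A : Set a} {u v u′ v′ x y : A} → Joins u v x y → Joins u′ v′ x y → Joins u v u′ v′
Joins-trans (inj₁ (refl , refl)) (inj₁ (refl , refl)) = inj₁ (refl , refl)
Joins-trans (inj₁ (refl , refl)) (inj₂ (refl , refl)) = inj₂ (refl , refl)
Joins-trans (inj₂ (refl , refl)) (inj₁ (refl , refl)) = inj₂ (refl , refl)
Joins-trans (inj₂ (refl , refl)) (inj₂ (refl , refl)) = inj₁ (refl , refl)

Joins-oriented : ∀ {a} {A : Set a} (f : A → ℕ) {u v x y : A} →
                 f y ≡ suc (f x) → f v ≡ suc (f u) → Joins u v x y → x ≡ u × y ≡ v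
Joins-oriented f fy fv (inj₁ p) = p
Joins-oriented f {y = y} fy fv (inj₂ (refl , refl)) =
  ⊥-elim (<⇒≢ (m<n⇒m<1+n (n<1+n (f y))) (trans fy (cong suc fv)))

edgeOnList-sym : ∀ {A : Set} {u v : A} xs → EdgeOnList u v xs → EdgeOnList v u xs
edgeOnList-sym (x ∷ y ∷ xs) (inj₁ j) = inj₁ (Joins-sym j)
edgeOnList-sym (x ∷ y ∷ xs) (inj₂ e) = inj₂ (edgeOnList-sym (y ∷ xs) e)

edgeOnList-applyUpTo⁺ : ∀ {A : Set} (h : ℕ → A) {n p} → p < n → EdgeOnList (h p) (h (suc p)) (applyUpTo h (suc n))
edgeOnList-applyUpTo⁺ h {p = zero}  (s≤s _)   = inj₁ (inj₁ (refl , refl))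
edgeOnList-applyUpTo⁺ h {p = suc p} (s≤s p<n) = inj₂ (edgeOnList-applyUpTo⁺ (h ∘ suc) p<n)

edgeOnList-applyUpTo⁻ : ∀ {A : Set} {u v : A} (h : ℕ → A) n → EdgeOnList u v (applyUpTo h (suc n)) →
                        ∃[ p ] p < n × Joins u v (h p) (h (suc p))
edgeOnList-applyUpTo⁻ h (suc n) (inj₁ j) = zero , s≤s z≤n , j
edgeOnList-applyUpTo⁻ h (suc n) (inj₂ e) =
  let p , p<n , j = edgeOnList-applyUpTo⁻ (h ∘ suc) n e in suc p , s≤s p<n , j

-- The p-th entry of x ∷ xs; beyond the end it is stuck at the last entry.
nth : ∀ {A : Set} → A → List A → ℕ → A
nth x xs       zero    = x
nth x []       (suc p) = x
nth x (y ∷ ys) (suc p) = nth y ys p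

applyUpTo-nth : ∀ {A : Set} (x : A) xs → x ∷ xs ≡ applyUpTo (nth x xs) (suc (length xs))
applyUpTo-nth x []       = refl
applyUpTo-nth x (y ∷ ys) = cong (x ∷_) (applyUpTo-nth y ys)

lastOf-applyUpTo : ∀ {A : Set} (h : ℕ → A) n → lastOf (h 0) (applyUpTo (h ∘ suc) n) ≡ h n
lastOf-applyUpTo h zero    = refl
lastOf-applyUpTo h (suc n) = lastOf-applyUpTo (h ∘ suc) n

lastOf-++ : ∀ {A : Set} (x : A) xs ys → lastOf x (xs ++ ys) ≡ lastOf (lastOf x xs) ys
lastOf-++ x []       ys = refl
lastOf-++ x (y ∷ xs) ys = lastOf-++ y xs ys

edgeOnList-position : ∀ {A : Set} {u v : A} x xs → EdgeOnList u v (x ∷ xs) →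
                      ∃[ p ] p < length xs × Joins u v (nth x xs p) (nth x xs (suc p))
edgeOnList-position x xs on =
  edgeOnList-applyUpTo⁻ (nth x xs) (length xs) (subst (EdgeOnList _ _) (applyUpTo-nth x xs) on)

2*n≡n+n : ∀ n → 2 * n ≡ n + n
2*n≡n+n n = cong (n +_) (+-identityʳ n)

bottomRoute-≤ : ∀ r {i j} → i ≤ j → i + j ≤ 2 * r → i + (r + ∣ r - j ∣) ≤ 2 * r
bottomRoute-≤ r {i} {j} i≤j i+j≤2r with ≤-total j r
... | inj₁ j≤r = begin
  i + (r + ∣ r - j ∣)  ≡⟨ cong (λ d → i + (r + d)) (m≤n⇒∣n-m∣≡n∸m j≤r) ⟩
  i + (r + (r ∸ j))    ≡⟨ x∙yz≈y∙xz i r (r ∸ j) ⟩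
  r + (i + (r ∸ j))    ≤⟨ +-monoʳ-≤ r (+-monoˡ-≤ (r ∸ j) i≤j) ⟩
  r + (j + (r ∸ j))    ≡⟨ cong (r +_) (m+[n∸m]≡n j≤r) ⟩
  r + r                ≡⟨ 2*n≡n+n r ⟨
  2 * r                ∎
  where open ≤-Reasoning
... | inj₂ r≤j = begin
  i + (r + ∣ r - j ∣)  ≡⟨ cong (λ d → i + (r + d)) (m≤n⇒∣m-n∣≡n∸m r≤j) ⟩
  i + (r + (j ∸ r))    ≡⟨ cong (i +_) (m+[n∸m]≡n r≤j) ⟩
  i + j                ≤⟨ i+j≤2r ⟩
  2 * r                ∎
  where open ≤-Reasoning

topRoute-≤ : ∀ r {i j} → i ≤ j → j ≤ 2 * r → 2 * r ≤ i + j → ∣ i - r ∣ + (r + (2 * r ∸ j)) ≤ 2 * r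
topRoute-≤ r {i} {j} i≤j j≤2r 2r≤i+j with ≤-total i r
... | inj₁ i≤r = +-cancelʳ-≤ (2 * r) _ _ (begin
  ∣ i - r ∣ + (r + (2 * r ∸ j)) + 2 * r    ≡⟨ cong (λ d → d + (r + (2 * r ∸ j)) + 2 * r) (m≤n⇒∣m-n∣≡n∸m i≤r) ⟩
  (r ∸ i) + (r + (2 * r ∸ j)) + 2 * r      ≤⟨ +-monoʳ-≤ ((r ∸ i) + (r + (2 * r ∸ j))) 2r≤i+j ⟩
  (r ∸ i) + (r + (2 * r ∸ j)) + (i + j)    ≡⟨ regroup (r ∸ i) r (2 * r ∸ j) i j ⟩
  ((r ∸ i) + i) + r + ((2 * r ∸ j) + j)    ≡⟨ cong₂ (λ a b → a + r + b) (m∸n+n≡m i≤r) (m∸n+n≡m j≤2r) ⟩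
  r + r + 2 * r                            ≡⟨ cong (_+ 2 * r) (2*n≡n+n r) ⟨
  2 * r + 2 * r                            ∎)
  where
  open ≤-Reasoning
  regroup : ∀ a r b i j → a + (r + b) + (i + j) ≡ (a + i) + r + (b + j)
  regroup = solve-∀
... | inj₂ r≤i = begin
  ∣ i - r ∣ + (r + (2 * r ∸ j))    ≡⟨ cong (_+ (r + (2 * r ∸ j))) (m≤n⇒∣n-m∣≡n∸m r≤i) ⟩
  (i ∸ r) + (r + (2 * r ∸ j))      ≡⟨ +-assoc (i ∸ r) r _ ⟨
  (i ∸ r) + r + (2 * r ∸ j)        ≡⟨ cong (_+ (2 * r ∸ j)) (m∸n+n≡m r≤i) ⟩
  i + (2 * r ∸ j)                  ≤⟨ +-monoˡ-≤ _ i≤j ⟩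
  j + (2 * r ∸ j)                  ≡⟨ m+[n∸m]≡n j≤2r ⟩
  2 * r                            ∎
  where open ≤-Reasoning

-- Like fromℕ< without the bound: exact for n ≤ m (toℕ-clamp), junk beyond.
clamp : ∀ m → ℕ → Fin (suc m)
clamp m       zero    = zero
clamp zero    (suc n) = zero
clamp (suc m) (suc n) = suc (clamp m n)

toℕ-clamp : ∀ {m n} → n ≤ m → toℕ (clamp m n) ≡ n
toℕ-clamp {m}     {zero}  _         = refl
toℕ-clamp {suc m} {suc n} (s≤s n≤m) = cong suc (toℕ-clamp n≤m)

toℕ-clamp-suc : ∀ {m n} → suc n ≤ m → toℕ (clamp m (suc n)) ≡ suc (toℕ (clamp m n))
toℕ-clamp-suc n<m = trans (toℕ-clamp n<m) (cong suc (sym (toℕ-clamp (<⇒≤ n<m))))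

clamp-toℕ : ∀ {m} (i : Fin (suc m)) → clamp m (toℕ i) ≡ i
clamp-toℕ {m}     zero    = refl
clamp-toℕ {suc m} (suc i) = cong suc (clamp-toℕ i)

module BenesNetwork (r : ℕ) where

  bitIndex-low : ∀ {t} → t < r → bitIndex r t ≡ t
  bitIndex-low {t} t<r with t <ᵇ r | <ᵇ-reflects-< t r
  ... | true  | _        = refl
  ... | false | ofⁿ t≮r = ⊥-elim (t≮r t<r)

  bitIndex-high : ∀ {m} → m < r → bitIndex r (m + r) ≡ r ∸ suc m
  bitIndex-high {m} m<r with (m + r) <ᵇ r | <ᵇ-reflects-< (m + r) r
  ... | true  | ofʸ m+r<r = ⊥-elim (m+n≮n m r m+r<r)
  ... | false | _         = begin
    (2 * r ∸ 1) ∸ (m + r)    ≡⟨ ∸-+-assoc (2 * r) 1 (m + r) ⟩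
    2 * r ∸ suc (m + r)      ≡⟨ cong₂ _∸_ (2*n≡n+n r) (cong suc (+-comm m r)) ⟩
    (r + r) ∸ suc (r + m)    ≡⟨ cong ((r + r) ∸_) (sym (+-suc r m)) ⟩
    (r + r) ∸ (r + suc m)    ≡⟨ [m+n]∸[m+o]≡n∸o r r (suc m) ⟩
    r ∸ suc m                ∎
    where open ≡-Reasoning

  bitIndex-< : ∀ {t} → t < 2 * r → bitIndex r t < r
  bitIndex-< {t} t<2r with t <? r
  ... | yes t<r = subst (_< r) (sym (bitIndex-low t<r)) t<r
  ... | no  t≮r = subst (_< r) (sym bitIndex-t) (∸-monoʳ-< z<s t∸r<r)
    where
    r≤t : r ≤ t
    r≤t = ≮⇒≥ t≮r
    t∸r<r : t ∸ r < r
    t∸r<r = subst (t ∸ r <_) (m+n∸n≡m r r) (∸-monoˡ-< (subst (t <_) (2*n≡n+n r) t<2r) r≤t)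
    bitIndex-t : bitIndex r t ≡ r ∸ suc (t ∸ r)
    bitIndex-t = trans (cong (bitIndex r) (sym (m∸n+n≡m r≤t))) (bitIndex-high t∸r<r)

  level : Vertex r → ℕ
  level = toℕ ∘ proj₂

  level≤2r : ∀ u → level u ≤ 2 * r
  level≤2r (_ , i) = s≤s⁻¹ (toℕ<n i)

  vertex : Vec Bool r → ℕ → Vertex r
  vertex s l = s , clamp (2 * r) l

  vertex-level : ∀ u → vertex (proj₁ u) (level u) ≡ u
  vertex-level (s , i) = cong (s ,_) (clamp-toℕ i)

  up-edge : ∀ {l s s′} c → suc l ≤ 2 * r → s′ ≡ flipIf c (bitIndex r l) s → Adj r (vertex s l) (vertex s′ (suc l))
  up-edge {l} {s} c l<2r refl
    rewrite toℕ-clamp (<⇒≤ l<2r) | toℕ-clamp l<2r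
    = inj₁ (refl , flipIf-sameOrDiffExactlyAt c (bitIndex r l) s)

  adj-level-≤ : ∀ {u v} → Adj r u v → level v ≤ suc (level u)
  adj-level-≤ (inj₁ (lv , _)) = ≤-reflexive lv
  adj-level-≤ (inj₂ (lu , _)) = ≤-trans (n≤1+n _) (≤-trans (≤-reflexive (sym lu)) (n≤1+n _))

  level-lastOf-≤ : ∀ x xs → Chain {r} (x ∷ xs) → level (lastOf x xs) ≤ level x + length xs
  level-lastOf-≤ x []       _         = m≤m+n (level x) 0
  level-lastOf-≤ x (y ∷ ys) (x~y , c) = begin
    level (lastOf y ys)         ≤⟨ level-lastOf-≤ y ys c ⟩
    level y + length ys         ≤⟨ +-monoˡ-≤ (length ys) (adj-level-≤ x~y) ⟩
    suc (level x) + length ys   ≡⟨ +-suc (level x) (length ys) ⟨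
    level x + length (y ∷ ys)   ∎
    where open ≤-Reasoning

  chain-applyUpTo : ∀ (h : ℕ → Vertex r) n → (∀ {m} → m < n → Adj r (h m) (h (suc m))) →
                    Chain {r} (applyUpTo h (suc n))
  chain-applyUpTo h zero    adj = tt
  chain-applyUpTo h (suc n) adj = adj z<s , chain-applyUpTo (h ∘ suc) n (adj ∘ s≤s)

  -- Walks and the diameter

  record Walk (x y : Vertex r) (n : ℕ) : Set where
    constructor walk
    field
      steps   : List (Vertex r)
      isChain : Chain {r} (x ∷ steps)
      ends    : lastOf x steps ≡ y
      bounded : length steps ≤ n

  weakenᵂ : ∀ {x y m n} → m ≤ n → Walk x y m → Walk x y n
  weakenᵂ m≤n (walk xs c e b) = walk xs c e (≤-trans b m≤n)

  walkAlong : (h : ℕ → Vertex r) (n : ℕ) → (∀ {m} → m < n → Adj r (h m) (h (suc m))) → Walk (h 0) (h n) n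
  walkAlong h n adj =
    walk (applyUpTo (h ∘ suc) n) (chain-applyUpTo h n adj) (lastOf-applyUpTo h n) (≤-reflexive (length-applyUpTo _ n))

  chain-++ : ∀ x xs ys → Chain {r} (x ∷ xs) → Chain {r} (lastOf x xs ∷ ys) → Chain {r} (x ∷ xs ++ ys)
  chain-++ x []       ys _         c = c
  chain-++ x (y ∷ xs) ys (x~y , c) c′ = x~y , chain-++ y xs ys c c′

  _++ᵂ_ : ∀ {x y z m n} → Walk x y m → Walk y z n → Walk x z (m + n)
  _++ᵂ_ {x} (walk xs c refl b) (walk ys c′ refl b′) =
    walk (xs ++ ys) (chain-++ x xs ys c c′) (lastOf-++ x xs ys) (≤-trans (≤-reflexive (length-++ xs)) (+-mono-≤ b b′))
  infixr 5 _++ᵂ_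

  reverseChain : ∀ x xs → Chain {r} (x ∷ xs) → Walk (lastOf x xs) x (length xs)
  reverseChain x []       _         = walk [] tt refl z≤n
  reverseChain x (y ∷ ys) (x~y , c) =
    weakenᵂ (≤-reflexive (+-comm (length ys) 1)) (reverseChain y ys c ++ᵂ walk (x ∷ []) (swap x~y , tt) refl ≤-refl)

  reverseᵂ : ∀ {x y n} → Walk x y n → Walk y x n
  reverseᵂ {x} (walk xs c refl b) = weakenᵂ b (reverseChain x xs c)

  ascend : ∀ s {a b} → a ≤ b → b ≤ 2 * r → Walk (vertex s a) (vertex s b) (b ∸ a)
  ascend s {a} {b} a≤b b≤2r =
    subst (λ l → Walk (vertex s a) (vertex s l) (b ∸ a)) (m∸n+n≡m a≤b) (walkAlong (λ m → vertex s (m + a)) (b ∸ a) stay)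
    where
    stay : ∀ {m} → m < b ∸ a → Adj r (vertex s (m + a)) (vertex s (suc m + a))
    stay m<b∸a = up-edge false (≤-trans (+-monoˡ-≤ a m<b∸a) (≤-trans (≤-reflexive (m∸n+n≡m a≤b)) b≤2r)) refl

  vertical : ∀ s {a b} → a ≤ 2 * r → b ≤ 2 * r → Walk (vertex s a) (vertex s b) ∣ a - b ∣
  vertical s {a} {b} a≤2r b≤2r with a ≤? b
  ... | yes a≤b = weakenᵂ (≤-reflexive (sym (m≤n⇒∣m-n∣≡n∸m a≤b))) (ascend s a≤b b≤2r)
  ... | no  a≰b = weakenᵂ (≤-reflexive (sym (m≤n⇒∣n-m∣≡n∸m b≤a))) (reverseᵂ (ascend s b≤a a≤2r))
    where b≤a = ≰⇒≥ a≰b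

  r≤2r : r ≤ 2 * r
  r≤2r = m≤m+n r (r + 0)

  lowerButterfly : ∀ s s′ → Walk (vertex s 0) (vertex s′ r) r
  lowerButterfly s s′ =
    subst (λ x → Walk (vertex s 0) (vertex x r) r) (splice-full s′ s) (walkAlong (λ m → vertex (splice m s′ s) m) r step)
    where
    step : ∀ {m} → m < r → Adj r (vertex (splice m s′ s) m) (vertex (splice (suc m) s′ s) (suc m))
    step {m} m<r = let c , eq = splice-suc m s′ s in
      up-edge c (≤-trans m<r r≤2r) (trans eq (cong (λ b → flipIf c b (splice m s′ s)) (sym (bitIndex-low m<r))))

  upperButterfly : ∀ s s′ → Walk (vertex s r) (vertex s′ (2 * r)) r
  upperButterfly s s′ =
    subst₂ (λ x y → Walk x y r) (cong (λ x → vertex x r) (splice-full s s′))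
      (cong₂ vertex (cong (λ m → splice m s s′) (n∸n≡0 r)) (sym (2*n≡n+n r)))
      (walkAlong (λ m → vertex (splice (r ∸ m) s s′) (m + r)) r step)
    where
    step : ∀ {m} → m < r → Adj r (vertex (splice (r ∸ m) s s′) (m + r)) (vertex (splice (r ∸ suc m) s s′) (suc m + r))
    step {m} m<r = let c , eq = splice-suc k s s′ in
      up-edge c (subst (suc m + r ≤_) (sym (2*n≡n+n r)) (+-monoˡ-≤ r m<r)) (begin
        splice k s s′                                 ≡⟨ flipIf-involutive c k _ ⟨
        flipIf c k (flipIf c k (splice k s s′))       ≡⟨ cong (flipIf c k) eq ⟨
        flipIf c k (splice (suc k) s s′)              ≡⟨ cong₂ (flipIf c) (sym (bitIndex-high m<r)) (cong (λ l → splice l s s′) 1+k≡r∸m) ⟩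
        flipIf c (bitIndex r (m + r)) (splice (r ∸ m) s s′) ∎)
      where
      open ≡-Reasoning
      k = r ∸ suc m
      1+k≡r∸m : suc k ≡ r ∸ m
      1+k≡r∸m = sym (+-∸-assoc 1 m<r)

  route : ∀ s s′ {i j} → i ≤ j → j ≤ 2 * r → Walk (vertex s i) (vertex s′ j) (2 * r)
  route s s′ {i} {j} i≤j j≤2r with i + j ≤? 2 * r
  ... | yes i+j≤2r = weakenᵂ (bottomRoute-≤ r i≤j i+j≤2r)
        (reverseᵂ (ascend s z≤n i≤2r) ++ᵂ lowerButterfly s s′ ++ᵂ vertical s′ r≤2r j≤2r)
    where i≤2r = ≤-trans i≤j j≤2r
  ... | no  i+j≰2r = weakenᵂ (topRoute-≤ r i≤j j≤2r (≰⇒≥ i+j≰2r))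
        (vertical s i≤2r r≤2r ++ᵂ upperButterfly s s′ ++ᵂ reverseᵂ (ascend s′ j≤2r ≤-refl))
    where i≤2r = ≤-trans i≤j j≤2r

  diameter : ∀ u v → Walk u v (2 * r)
  diameter u v with level u ≤? level v
  ... | yes lu≤lv = subst₂ (λ x y → Walk x y (2 * r)) (vertex-level u) (vertex-level v)
                      (route (proj₁ u) (proj₁ v) lu≤lv (level≤2r v))
  ... | no  lu≰lv = reverseᵂ (subst₂ (λ x y → Walk x y (2 * r)) (vertex-level v) (vertex-level u)
                      (route (proj₁ v) (proj₁ u) (≰⇒≥ lu≰lv) (level≤2r u)))

  geodesic-length-≤ : (g : Geodesic r) → length (rest g) ≤ 2 * r
  geodesic-length-≤ g with diameter (start g) (lastOf (start g) (rest g))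
  ... | walk xs c e b = ≤-trans (shortest g xs c e) b

  risingGeodesic : (h : ℕ → Vertex r) → (∀ {m} → m < 2 * r → Adj r (h m) (h (suc m))) →
                   level (h 0) ≡ 0 → level (h (2 * r)) ≡ 2 * r → Geodesic r
  risingGeodesic h adj bottom top = record
    { start    = h 0
    ; rest     = applyUpTo (h ∘ suc) (2 * r)
    ; chain    = chain-applyUpTo h (2 * r) adj
    ; shortest = λ rest′ c e → begin
        length (applyUpTo (h ∘ suc) (2 * r))  ≡⟨ length-applyUpTo (h ∘ suc) (2 * r) ⟩
        2 * r                                 ≡⟨ top ⟨
        level (h (2 * r))                     ≡⟨ cong level (trans e (lastOf-applyUpTo h (2 * r))) ⟨
        level (lastOf (h 0) rest′)            ≤⟨ level-lastOf-≤ (h 0) rest′ c ⟩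
        level (h 0) + length rest′            ≡⟨ cong (_+ length rest′) bottom ⟩
        length rest′                          ∎
    }
    where open ≤-Reasoning

  -- Edges and the lower bound

  EdgeCode : Set
  EdgeCode = Fin (2 * r) × Vec Bool (suc r)

  tailOf headOf : EdgeCode → Vertex r
  tailOf (t , c ∷ s) = vertex s (toℕ t)
  headOf (t , c ∷ s) = vertex (flipIf c (bitIndex r (toℕ t)) s) (suc (toℕ t))

  edgeCode-adj : ∀ e → Adj r (tailOf e) (headOf e)
  edgeCode-adj (t , c ∷ s) = up-edge c (toℕ<n t) refl

  level-tailOf : ∀ e → level (tailOf e) ≡ toℕ (proj₁ e)
  level-tailOf (t , _ ∷ _) = toℕ-clamp (<⇒≤ (toℕ<n t))

  level-headOf : ∀ e → level (headOf e) ≡ suc (level (tailOf e))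
  level-headOf (t , c ∷ s) = toℕ-clamp-suc (toℕ<n t)

  edgeCode-injective : ∀ e e′ → Joins (tailOf e) (headOf e) (tailOf e′) (headOf e′) → e′ ≡ e
  edgeCode-injective (t , c ∷ s) (t′ , c′ ∷ s′) joins
    with Joins-oriented level (level-headOf (t′ , c′ ∷ s′)) (level-headOf (t , c ∷ s)) joins
  ... | tails , heads
    with toℕ-injective (trans (sym (level-tailOf (t′ , c′ ∷ s′))) (trans (cong level tails) (level-tailOf (t , c ∷ s))))
  ... | refl with cong proj₁ tails
  ... | refl = cong (λ c → t , c ∷ s) (flipIf-injective s (bitIndex-< (toℕ<n t)) (cong proj₁ heads))

  up⇒edgeCode : ∀ {u v} → Up r u v → ∃[ e ] tailOf e ≡ u × headOf e ≡ v
  up⇒edgeCode {s , i} {s′ , j} (j≡1+i , step) = (t , c ∷ s) , tail≡ , head≡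
    where
    i<2r : toℕ i < 2 * r
    i<2r = subst (_≤ 2 * r) j≡1+i (level≤2r (s′ , j))
    t = fromℕ< i<2r
    c = proj₁ (sameOrDiffExactlyAt⇒flipIf (bitIndex r (toℕ i)) step)
    tail≡ : vertex s (toℕ t) ≡ (s , i)
    tail≡ = trans (cong (vertex s) (toℕ-fromℕ< i<2r)) (vertex-level (s , i))
    head≡ : vertex (flipIf c (bitIndex r (toℕ t)) s) (suc (toℕ t)) ≡ (s′ , j)
    head≡ rewrite toℕ-fromℕ< i<2r =
      trans (cong₂ vertex (sym (proj₂ (sameOrDiffExactlyAt⇒flipIf (bitIndex r (toℕ i)) step))) (sym j≡1+i)) (vertex-level (s′ , j))

  EdgeCode↔Fin : EdgeCode ↔ Fin (2 * r * 2 ^ suc r)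
  EdgeCode↔Fin = ↔-trans (↔-refl ×-↔ Bits↔Fin (suc r)) (↔-sym *↔×)

  module CoverSlots {k} (f : Fin k → Geodesic r) (cover : IsEdgeGeodesicCover r k f) where

    vertexAt : Fin k → ℕ → Vertex r
    vertexAt i = nth (start (f i)) (rest (f i))

    index : EdgeCode → Fin k
    index e = proj₁ (cover (tailOf e) (headOf e) (edgeCode-adj e))

    located : ∀ e → ∃[ p ] p < length (rest (f (index e))) ×
                    Joins (tailOf e) (headOf e) (vertexAt (index e) p) (vertexAt (index e) (suc p))
    located e = edgeOnList-position _ _ (proj₂ (cover (tailOf e) (headOf e) (edgeCode-adj e)))

    position : EdgeCode → ℕ
    position e = proj₁ (located e)

    slot : EdgeCode → Fin k × Fin (2 * r)
    slot e = index e , fromℕ< (≤-trans (proj₁ (proj₂ (located e))) (geodesic-length-≤ (f (index e))))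

    slot-injective : ∀ {e e′} → slot e ≡ slot e′ → e ≡ e′
    slot-injective {e} {e′} eq = edgeCode-injective e′ e (Joins-trans (joins e′) (subst₂ (JoinedAt e) i≡i′ p≡p′ (joins e)))
      where
      JoinedAt : EdgeCode → Fin k → ℕ → Set
      JoinedAt e i p = Joins (tailOf e) (headOf e) (vertexAt i p) (vertexAt i (suc p))
      joins : ∀ e → JoinedAt e (index e) (position e)
      joins e = proj₂ (proj₂ (located e))
      i≡i′ : index e ≡ index e′
      i≡i′ = cong proj₁ eq
      p≡p′ : position e ≡ position e′
      p≡p′ = trans (sym (toℕ-fromℕ< _)) (trans (cong (toℕ ∘ proj₂) eq) (toℕ-fromℕ< _))

  cover⇒2^[1+r]≤k : 1 ≤ r → ∀ k (f : Fin k → Geodesic r) → IsEdgeGeodesicCover r k f → 2 ^ suc r ≤ k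
  cover⇒2^[1+r]≤k 1≤r k f cover = *-cancelʳ-≤ (2 ^ suc r) k (2 * r) {{>-nonZero (≤-trans 1≤r r≤2r)}}
    (subst (_≤ k * (2 * r)) (*-comm (2 * r) (2 ^ suc r))
      (↣⇒≤ EdgeCode↔Fin (↔-sym *↔×) (mk↣ slot-injective)))
    where open CoverSlots f cover

  -- The 2^(r+1) rising geodesics

  trail : Bool → Vec Bool r → ℕ → Vec Bool r
  trail c s zero    = s
  trail c s (suc m) = flipIf c (bitIndex r m) (trail c s m)

  untrail : Bool → Vec Bool r → ℕ → Vec Bool r
  untrail c s zero    = s
  untrail c s (suc m) = untrail c (flipIf c (bitIndex r m) s) m

  trail-untrail : ∀ c s m → trail c (untrail c s m) m ≡ s
  trail-untrail c s zero    = refl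
  trail-untrail c s (suc m) =
    trans (cong (flipIf c (bitIndex r m)) (trail-untrail c (flipIf c (bitIndex r m) s) m)) (flipIf-involutive c _ s)

  untrail-trail : ∀ c s m → untrail c (trail c s m) m ≡ s
  untrail-trail c s zero    = refl
  untrail-trail c s (suc m) =
    trans (cong (λ x → untrail c x m) (flipIf-involutive c _ (trail c s m))) (untrail-trail c s m)

  trailVertex : Bool → Vec Bool r → ℕ → Vertex r
  trailVertex c s m = vertex (trail c s m) m

  geodesic : Vec Bool (suc r) → Geodesic r
  geodesic (c ∷ s) = risingGeodesic (trailVertex c s) (λ m<2r → up-edge c m<2r refl)
                       refl (toℕ-clamp ≤-refl)

  through : EdgeCode → Vec Bool (suc r)
  through (t , c ∷ s) = c ∷ untrail c s (toℕ t)

  edgeOn-through : ∀ e → EdgeOn (tailOf e) (headOf e) (geodesic (through e))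
  edgeOn-through (t , c ∷ s) =
    subst (λ x → EdgeOnList (vertex x (toℕ t)) (vertex (flipIf c (bitIndex r (toℕ t)) x) (suc (toℕ t)))
                            (applyUpTo (trailVertex c w) (suc (2 * r))))
      (trail-untrail c s (toℕ t)) (edgeOnList-applyUpTo⁺ (trailVertex c w) (toℕ<n t))
    where w = untrail c s (toℕ t)

  edgeOn⇒through : ∀ e w → EdgeOn (tailOf e) (headOf e) (geodesic w) → w ≡ through e
  edgeOn⇒through (t , c ∷ s) (c′ ∷ w) on
    with edgeOnList-applyUpTo⁻ (trailVertex c′ w) (2 * r) on
  ... | p , p<2r , joins
    with Joins-oriented level (toℕ-clamp-suc p<2r) (level-headOf (t , c ∷ s)) joins
  ... | tails , heads
    with trans (sym (toℕ-clamp (<⇒≤ p<2r))) (trans (cong level tails) (level-tailOf (t , c ∷ s)))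
  ... | refl with cong proj₁ tails
  ... | refl with flipIf-injective {c = c′} {c} (trail c′ w p) (bitIndex-< p<2r) (cong proj₁ heads)
  ... | refl = cong (c ∷_) (sym (untrail-trail c w p))

  family : Fin (2 ^ suc r) → Geodesic r
  family = geodesic ∘ Inverse.from (Bits↔Fin (suc r))

  family-partition-edgeCode : ∀ e → ∃[ i ] EdgeOn (tailOf e) (headOf e) (family i) ×
                                          (∀ j → EdgeOn (tailOf e) (headOf e) (family j) → j ≡ i)
  family-partition-edgeCode e =
    to (through e) ,
    subst (EdgeOn (tailOf e) (headOf e) ∘ geodesic) (sym (strictlyInverseʳ (through e))) (edgeOn-through e) ,
    λ j on → trans (sym (strictlyInverseˡ j)) (cong to (edgeOn⇒through e (from j) on))
    where open Inverse (Bits↔Fin (suc r))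

  family-partition : IsEdgeGeodesicPartition r (2 ^ suc r) family
  family-partition u v (inj₁ up) with up⇒edgeCode up
  ... | e , refl , refl = family-partition-edgeCode e
  family-partition u v (inj₂ up) with up⇒edgeCode up
  ... | e , refl , refl =
    let i , on , unique = family-partition-edgeCode e
    in i , edgeOnList-sym _ on , λ j on′ → unique j (edgeOnList-sym _ on′)

partition⇒cover : ∀ {r k} (f : Fin k → Geodesic r) → IsEdgeGeodesicPartition r k f → IsEdgeGeodesicCover r k f
partition⇒cover f partition u v u~v = let i , on , _ = partition u v u~v in i , on

theorem5p1 : (r : ℕ) → 3 ≤ r → GcoverE≡ r (2 ^ (r + 1)) × GpartE≡ r (2 ^ (r + 1))
theorem5p1 r 3≤r rewrite +-comm r 1 =
  ((family , partition⇒cover family family-partition) , cover⇒2^[1+r]≤k 1≤r) ,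
  ((family , family-partition) , λ k f partition → cover⇒2^[1+r]≤k 1≤r k f (partition⇒cover f partition))
  where
  open BenesNetwork r
  1≤r : 1 ≤ r
  1≤r = ≤-trans (s≤s z≤n) 3≤r
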